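{- For $i=1,2$, let $G_i$ be an $m_i$-$\gamma_t$-critical graph of order $\Delta(G_i)+m_i$ with minimum degree $\delta(G_i)\ge 2$, and let $v_i\in V(G_i)$ be a vertex of maximum degree $\Delta(G_i)$ in $G_i$. Suppose that, for each $i$, every connected component of the induced subgraph $G_i[V(G_i)\setminus N[v_i]]$ is a path $P_2$. Let $G$ be the vertex amalgamation of $G_1$ and $G_2$ with $v_1$ and $v_2$. Then $\Delta(G)=\Delta(G_1)+\Delta(G_2)$ and $G$ is an $(m_1+m_2-1)$-$\gamma_t$-critical graph of order $\Delta(G)+m_1+m_2-1$.
   Context: For a graph $G$, a set $S\subseteq V(G)$ is a total dominating set if every vertex of $G$ is adjacent to some vertex of $S$; $\gamma_t(G)$ is the minimum size of such a set. A leaf is a vertex of degree one. A graph $G$ with no isolated vertex is $\gamma_t$-critical if $\gamma_t(G-v)<\gamma_t(G)$ for every vertex $v$ not adjacent to a leaf, and $m$-$\gamma_t$-critical if also $\gamma_t(G)=m$. $N(v)$ is the neighborhood of $v$ and $N[v]=N(v)\cup\{v\}$. The vertex amalgamation of $G_1$ and $G_2$ with $v_1\in V(G_1)$, $v_2\in V(G_2)$ is the graph with vertex set $(V(G_1)\setminus\{v_1\})\cup(V(G_2)\setminus\{v_2\})\cup\{v\}$ ($v$ a new vertex) and edge set $E(G_1-v_1)\cup E(G_2-v_2)\cup\{vu: v_1u\in E(G_1)\}\cup\{vw: v_2w\in E(G_2)\}$. -}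

module Defs where

open import Data.Nat using (ℕ; zero; suc; _+_; _∸_; _≤_; _<_)
open import Data.Bool using (Bool; true; false)
open import Data.Fin using (Fin; zero; suc; splitAt; punchIn)
open import Data.Fin.Subset using (Subset; _∈_; _∉_; ∣_∣)
open import Data.Vec using (tabulate)
open import Data.Sum using (_⊎_; inj₁; inj₂)
open import Data.Unit using (⊤; tt)
open import Data.Product using (Σ; ∃; _×_; _,_)
open import Relation.Binary.PropositionalEquality using (_≡_; _≢_; refl)
open import Relation.Nullary using (¬_)

record Graph (n : ℕ) : Set where
  field
    adj    : Fin n → Fin n → Bool
    sym    : ∀ u v → adj u v ≡ adj v u
    irrefl : ∀ v → adj v v ≡ false
open Graph public

module _ {n : ℕ} (G : Graph n) where

  Adj : Fin n → Fin n → Set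
  Adj u v = adj G u v ≡ true

  N : Fin n → Subset n
  N v = tabulate (λ u → adj G v u)

  InClosedN : Fin n → Fin n → Set
  InClosedN v u = (u ≡ v) ⊎ Adj v u

  deg : Fin n → ℕ
  deg v = ∣ N v ∣

  IsLeaf : Fin n → Set
  IsLeaf v = deg v ≡ 1

  NoIsolated : Set
  NoIsolated = ∀ v → ∃ λ u → Adj v u

  MaxDegreeIs : ℕ → Set
  MaxDegreeIs d = (∃ λ v → deg v ≡ d) × (∀ v → deg v ≤ d)

  MinDegreeAtLeast : ℕ → Set
  MinDegreeAtLeast k = ∀ v → k ≤ deg v

  IsTDS : Subset n → Set
  IsTDS S = ∀ v → ∃ λ u → u ∈ S × Adj v u

  GammaT : ℕ → Set
  GammaT m = (∃ λ S → IsTDS S × ∣ S ∣ ≡ m) × (∀ S → IsTDS S → m ≤ ∣ S ∣)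

  -- S is a total dominating set of G - x (S avoids x and every vertex
  -- other than x has a neighbour in S)
  IsTDSMinus : Fin n → Subset n → Set
  IsTDSMinus x S = x ∉ S × (∀ v → v ≢ x → ∃ λ u → u ∈ S × Adj v u)

  -- γ_t(G - x) < m  (G - x has a total dominating set of size < m;
  -- if G - x has an isolated vertex, γ_t(G - x) = ∞ and this fails)
  GammaTMinusLess : Fin n → ℕ → Set
  GammaTMinusLess x m = ∃ λ S → IsTDSMinus x S × ∣ S ∣ < m

  AdjToLeaf : Fin n → Set
  AdjToLeaf v = ∃ λ u → Adj v u × IsLeaf u

  Critical : ℕ → Set
  Critical m = NoIsolated × GammaT m
             × (∀ v → ¬ AdjToLeaf v → GammaTMinusLess v m)

  Outside : Fin n → Fin n → Set
  Outside v u = ¬ InClosedN v u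

  -- walks inside H = G[V ∖ N[v]] : ReachOut v a b means b lies in the
  -- connected component of H containing a (a itself in H)
  data ReachOut (v : Fin n) (a : Fin n) : Fin n → Set where
    here : ReachOut v a a
    step : ∀ {b c} → ReachOut v a b → Adj b c → Outside v c → ReachOut v a c

  -- every connected component of G[V ∖ N[v]] is a path P₂: for every
  -- vertex a of H there is a vertex b of H adjacent to a such that the
  -- component of a in H is exactly {a , b}.
  ComponentsP2 : Fin n → Set
  ComponentsP2 v = ∀ a → Outside v a →
    ∃ λ b → Outside v b × Adj a b ×
      (∀ c → ReachOut v a c → (c ≡ a) ⊎ (c ≡ b))

-- The vertex set of the amalgamation of
-- G₁ (order suc k₁) at v₁ and G₂ (order suc k₂) at v₂ is
-- Fin (suc (k₁ + k₂)):  zero is the new vertex v, suc i for i with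
-- splitAt k₁ i = inj₁ j is vertex (punchIn v₁ j) of G₁ - v₁, and
-- inj₂ j is vertex (punchIn v₂ j) of G₂ - v₂.

module _ {k₁ k₂ : ℕ} (G₁ : Graph (suc k₁)) (v₁ : Fin (suc k₁))
                     (G₂ : Graph (suc k₂)) (v₂ : Fin (suc k₂)) where

  private
    V : Set
    V = ⊤ ⊎ (Fin k₁ ⊎ Fin k₂)

    dec : Fin (suc (k₁ + k₂)) → V
    dec zero    = inj₁ tt
    dec (suc i) = inj₂ (splitAt k₁ i)

    a : V → V → Bool
    a (inj₁ _)        (inj₁ _)        = false
    a (inj₁ _)        (inj₂ (inj₁ j)) = adj G₁ v₁ (punchIn v₁ j)
    a (inj₁ _)        (inj₂ (inj₂ j)) = adj G₂ v₂ (punchIn v₂ j)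
    a (inj₂ (inj₁ i)) (inj₁ _)        = adj G₁ (punchIn v₁ i) v₁
    a (inj₂ (inj₁ i)) (inj₂ (inj₁ j)) = adj G₁ (punchIn v₁ i) (punchIn v₁ j)
    a (inj₂ (inj₁ i)) (inj₂ (inj₂ j)) = false
    a (inj₂ (inj₂ i)) (inj₁ _)        = adj G₂ (punchIn v₂ i) v₂
    a (inj₂ (inj₂ i)) (inj₂ (inj₁ j)) = false
    a (inj₂ (inj₂ i)) (inj₂ (inj₂ j)) = adj G₂ (punchIn v₂ i) (punchIn v₂ j)

    a-sym : ∀ x y → a x y ≡ a y x
    a-sym (inj₁ _)        (inj₁ _)        = refl
    a-sym (inj₁ _)        (inj₂ (inj₁ j)) = sym G₁ v₁ (punchIn v₁ j)
    a-sym (inj₁ _)        (inj₂ (inj₂ j)) = sym G₂ v₂ (punchIn v₂ j)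
    a-sym (inj₂ (inj₁ i)) (inj₁ _)        = sym G₁ (punchIn v₁ i) v₁
    a-sym (inj₂ (inj₁ i)) (inj₂ (inj₁ j)) = sym G₁ (punchIn v₁ i) (punchIn v₁ j)
    a-sym (inj₂ (inj₁ i)) (inj₂ (inj₂ j)) = refl
    a-sym (inj₂ (inj₂ i)) (inj₁ _)        = sym G₂ (punchIn v₂ i) v₂
    a-sym (inj₂ (inj₂ i)) (inj₂ (inj₁ j)) = refl
    a-sym (inj₂ (inj₂ i)) (inj₂ (inj₂ j)) = sym G₂ (punchIn v₂ i) (punchIn v₂ j)

    a-irr : ∀ x → a x x ≡ false
    a-irr (inj₁ _)        = refl
    a-irr (inj₂ (inj₁ i)) = irrefl G₁ (punchIn v₁ i)
    a-irr (inj₂ (inj₂ i)) = irrefl G₂ (punchIn v₂ i)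

  amalgamation : Graph (suc (k₁ + k₂))
  amalgamation = record
    { adj    = λ x y → a (dec x) (dec y)
    ; sym    = λ x y → a-sym (dec x) (dec y)
    ; irrefl = λ x → a-irr (dec x)
    }

-- Write v for the vertex of G obtained by identifying v₁ and v₂.  A total dominating set S of G
-- restricts to sets T₁ ⊆ V(G₁) and T₂ ⊆ V(G₂) (v ↦ vᵢ) dominating every vertex except possibly vᵢ,
-- and v is dominated from one side, say T₁ is a total dominating set of G₁, so m₁ ≤ |T₁|.  On the
-- other side m₂ ≤ 1 + |T₂ - v₂|: either some neighbour of v₂ lies in T₂ and T₂ ∪ {v₂} is a total
-- dominating set, or none does, and then every vertex outside N[v₂] is in T₂ (its partner in the
-- P₂ component is dominated by a vertex that is outside N[v₂] as well, hence by the vertex itself),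
-- so Δ₂ + m₂ = |V(G₂)| ≤ |T₂ - v₂| + Δ₂ + 1.  Adding up, γₜ(G) ≥ m₁ + m₂ - 1.  Conversely, gluing
-- a γₜ-set of G₁ to a total dominating set of G₂ - v₂ of size < m₂ gives γₜ(G) ≤ m₁ + m₂ - 1, and
-- gluing the sets witnessing criticality of G₁ and G₂ at the corresponding vertices shows that G
-- is critical.  The degree of v is deg v₁ + deg v₂; all other degrees are unchanged.

module Submission where

open import Defs renaming (sym to adj-sym)
import Algebra.Properties.CommutativeSemigroup
open import Data.Bool using (Bool; true; false; _∨_; _≟_)
open import Data.Bool.Properties using (∨-identityʳ; ∨-zeroʳ)
open import Data.Empty using (⊥-elim)
open import Data.Fin using (Fin; zero; suc; punchIn; punchOut; _↑ˡ_; _↑ʳ_; splitAt)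
open import Data.Fin.Properties
  using (punchIn-injective; punchInᵢ≢i; punchIn-punchOut; any?; splitAt-↑ˡ; splitAt-↑ʳ; join-splitAt)
  renaming (_≟_ to _≟ᶠ_)
open import Data.Fin.Subset using (Subset; _∈_; _∉_; _⊆_; _∪_; ∣_∣; ⊤) renaming (⊥ to ∅)
open import Data.Fin.Subset.Properties
  using (_∈?_; ∉⊥; ∣⊤∣≡n; ∣⊥∣≡0; ∣p∣≤∣x∷p∣; p⊆q⇒∣p∣≤∣q∣; x∈p∪q⁺)
open import Data.Nat using (ℕ; zero; suc; _+_; _∸_; _≤_; _<_; z≤n; s≤s)
open import Data.Nat.Properties
  using (+-suc; +-comm; +-assoc; +-identityʳ; +-mono-≤; +-monoʳ-≤; +-cancelˡ-≤; ∸-monoˡ-≤;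
         ≤-trans; ≤-reflexive; ≤-antisym; m≤m+n; m≤n+m; suc-injective; +-commutativeSemigroup;
         module ≤-Reasoning)
open import Data.Product using (∃; _×_; _,_; proj₂)
open import Data.Sum using (_⊎_; inj₁; inj₂)
open import Data.Vec using (Vec; []; _∷_; _++_; lookup; tabulate; insertAt; removeAt)
import Data.Vec as Vec
open import Data.Vec.Properties
  using (lookup∘tabulate; tabulate∘lookup; tabulate-cong; lookup-++ˡ; lookup-++ʳ; lookup-replicate;
         insertAt-lookup; insertAt-punchIn; insertAt-removeAt; removeAt-insertAt; []=⇒lookup; lookup⇒[]=)
open import Relation.Binary.PropositionalEquality
open import Relation.Nullary using (¬_; Dec; yes; no)
open import Relation.Nullary.Decidable using (_×-dec_)

open Algebra.Properties.CommutativeSemigroup +-commutativeSemigroup using (interchange; x∙yz≈y∙xz)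

data PunchView {k : ℕ} (w : Fin (suc k)) : Fin (suc k) → Set where
  pivot   : PunchView w w
  punched : (j : Fin k) → PunchView w (punchIn w j)

punchView : ∀ {k} (w y : Fin (suc k)) → PunchView w y
punchView w y with w ≟ᶠ y
... | yes refl = pivot
... | no w≢y   = subst (PunchView w) (punchIn-punchOut w≢y) (punched (punchOut w≢y))

lookup-removeAt : ∀ {A : Set} {n} (xs : Vec A (suc n)) i j →
                  lookup (removeAt xs i) j ≡ lookup xs (punchIn i j)
lookup-removeAt xs i j =
  trans (sym (insertAt-punchIn (removeAt xs i) i (lookup xs i) j))
        (cong (λ ys → lookup ys (punchIn i j)) (insertAt-removeAt xs i))

bit : Bool → ℕ
bit true  = 1
bit false = 0

∣b∷p∣ : ∀ {n} b (p : Subset n) → ∣ b ∷ p ∣ ≡ bit b + ∣ p ∣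
∣b∷p∣ true  p = refl
∣b∷p∣ false p = refl

∣p++q∣ : ∀ {m n} (p : Subset m) (q : Subset n) → ∣ p ++ q ∣ ≡ ∣ p ∣ + ∣ q ∣
∣p++q∣ []          q = refl
∣p++q∣ (true ∷ p)  q = cong suc (∣p++q∣ p q)
∣p++q∣ (false ∷ p) q = ∣p++q∣ p q

∣insertAt∣ : ∀ {n} (p : Subset n) i b → ∣ insertAt p i b ∣ ≡ bit b + ∣ p ∣
∣insertAt∣ p           zero    b = ∣b∷p∣ b p
∣insertAt∣ (true ∷ p)  (suc i) b = trans (cong suc (∣insertAt∣ p i b)) (sym (+-suc (bit b) ∣ p ∣))
∣insertAt∣ (false ∷ p) (suc i) b = ∣insertAt∣ p i b

∉⇒lookup≡false : ∀ {n} {p : Subset n} {x} → x ∉ p → lookup p x ≡ false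
∉⇒lookup≡false {p = p} {x} x∉p with lookup p x in eq
... | true  = ⊥-elim (x∉p (lookup⇒[]= x p eq))
... | false = refl

lookup≡false⇒∉ : ∀ {n} {p : Subset n} {x} → lookup p x ≡ false → x ∉ p
lookup≡false⇒∉ eq x∈p with trans (sym eq) ([]=⇒lookup x∈p)
... | ()

∣removeAt∣ : ∀ {n} {p : Subset (suc n)} {i} → i ∉ p → ∣ removeAt p i ∣ ≡ ∣ p ∣
∣removeAt∣ {p = p} {i} i∉p = begin
  ∣ removeAt p i ∣                          ≡⟨⟩
  bit false + ∣ removeAt p i ∣              ≡⟨ cong (λ b → bit b + ∣ removeAt p i ∣) (∉⇒lookup≡false i∉p) ⟨
  bit (lookup p i) + ∣ removeAt p i ∣       ≡⟨ ∣insertAt∣ (removeAt p i) i (lookup p i) ⟨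
  ∣ insertAt (removeAt p i) i (lookup p i) ∣ ≡⟨ cong ∣_∣ (insertAt-removeAt p i) ⟩
  ∣ p ∣                                     ∎
  where open ≡-Reasoning

∣p∪q∣≤∣p∣+∣q∣ : ∀ {n} (p q : Subset n) → ∣ p ∪ q ∣ ≤ ∣ p ∣ + ∣ q ∣
∣p∪q∣≤∣p∣+∣q∣ []          []          = z≤n
∣p∪q∣≤∣p∣+∣q∣ (true ∷ p)  (c ∷ q)     =
  s≤s (≤-trans (∣p∪q∣≤∣p∣+∣q∣ p q) (+-monoʳ-≤ ∣ p ∣ (∣p∣≤∣x∷p∣ c q)))
∣p∪q∣≤∣p∣+∣q∣ (false ∷ p) (true ∷ q)  =
  ≤-trans (s≤s (∣p∪q∣≤∣p∣+∣q∣ p q)) (≤-reflexive (sym (+-suc ∣ p ∣ ∣ q ∣)))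
∣p∪q∣≤∣p∣+∣q∣ (false ∷ p) (false ∷ q) = ∣p∪q∣≤∣p∣+∣q∣ p q

⊆-insertAt-removeAt : ∀ {n} (p : Subset (suc n)) i {b} → (i ∈ p → b ≡ true) →
                      p ⊆ insertAt (removeAt p i) i b
⊆-insertAt-removeAt p i {b} i∈p⇒b {x} x∈p with punchView i x
... | pivot     = lookup⇒[]= i _ (trans (insertAt-lookup (removeAt p i) i b) (i∈p⇒b x∈p))
... | punched j = lookup⇒[]= (punchIn i j) _
  (trans (insertAt-punchIn (removeAt p i) i b j) (trans (lookup-removeAt p i j) ([]=⇒lookup x∈p)))

+∸1-mono-≤ʳ : ∀ {m₁ m₂ a c} → m₁ ≤ a → m₂ ≤ suc c → m₁ + m₂ ∸ 1 ≤ a + c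
+∸1-mono-≤ʳ {a = a} {c} m₁≤a m₂≤1+c =
  ∸-monoˡ-≤ 1 (≤-trans (+-mono-≤ m₁≤a m₂≤1+c) (≤-reflexive (+-suc a c)))

+∸1-mono-≤ˡ : ∀ {m₁ m₂ a c} → m₁ ≤ suc a → m₂ ≤ c → m₁ + m₂ ∸ 1 ≤ a + c
+∸1-mono-≤ˡ m₁≤1+a m₂≤c = ∸-monoˡ-≤ 1 (+-mono-≤ m₁≤1+a m₂≤c)

+-<⇒<+∸1 : ∀ {a c m₁ m₂} → a < m₁ → c < m₂ → a + c < m₁ + m₂ ∸ 1
+-<⇒<+∸1 {a} {c} {m₁} {m₂} a<m₁ c<m₂ =
  ∸-monoˡ-≤ 1 (subst (_≤ m₁ + m₂) (cong suc (+-suc a c)) (+-mono-≤ a<m₁ c<m₂))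

+-<ʳ⇒≤+∸1 : ∀ {m₁ c m₂} → c < m₂ → m₁ + c ≤ m₁ + m₂ ∸ 1
+-<ʳ⇒≤+∸1 {m₁} {c} {m₂} c<m₂ = ∸-monoˡ-≤ 1 (subst (_≤ m₁ + m₂) (+-suc m₁ c) (+-monoʳ-≤ m₁ c<m₂))

+-interchange-∸1 : ∀ {k₁ k₂ Δ₁ Δ₂ m₁ m₂} → suc k₁ ≡ Δ₁ + m₁ → suc k₂ ≡ Δ₂ + m₂ → 0 < m₂ →
                   suc (k₁ + k₂) ≡ (Δ₁ + Δ₂) + (m₁ + m₂ ∸ 1)
+-interchange-∸1 {k₁} {k₂} {Δ₁} {Δ₂} {m₁} {suc m₂} n₁ n₂ _ = begin
  suc k₁ + k₂                   ≡⟨ cong₂ _+_ n₁ (suc-injective (trans n₂ (+-suc Δ₂ m₂))) ⟩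
  (Δ₁ + m₁) + (Δ₂ + m₂)         ≡⟨ interchange Δ₁ m₁ Δ₂ m₂ ⟩
  (Δ₁ + Δ₂) + (m₁ + m₂)         ≡⟨ cong (λ m → (Δ₁ + Δ₂) + (m ∸ 1)) (+-suc m₁ m₂) ⟨
  (Δ₁ + Δ₂) + (m₁ + suc m₂ ∸ 1) ∎
  where open ≡-Reasoning

module _ {n : ℕ} (H : Graph n) where

  Dominated : Subset n → Fin n → Set
  Dominated S v = ∃ λ u → u ∈ S × Adj H v u

  DominatesAllBut : Fin n → Subset n → Set
  DominatesAllBut w S = ∀ v → v ≢ w → Dominated S v

  Dominated-mono : ∀ {S S′ v} → S ⊆ S′ → Dominated S v → Dominated S′ v
  Dominated-mono S⊆S′ (u , u∈S , vu) = u , S⊆S′ u∈S , vu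

  dominated? : ∀ S v → Dec (Dominated S v)
  dominated? S v = any? (λ u → (u ∈? S) ×-dec (adj H v u ≟ true))

  allBut⇒isTDS : ∀ {w S} → DominatesAllBut w S → Dominated S w → IsTDS H S
  allBut⇒isTDS {w} dom dw v with v ≟ᶠ w
  ... | yes refl = dw
  ... | no v≢w   = dom v v≢w

  γₜ⇒noIsolated : ∀ {m} → GammaT H m → NoIsolated H
  γₜ⇒noIsolated ((_ , tds , _) , _) v with tds v
  ... | u , _ , vu = u , vu

  adj⇒≢ : ∀ {u v} → Adj H u v → u ≢ v
  adj⇒≢ {u} uv refl with trans (sym uv) (irrefl H u)
  ... | ()

  lookup-N : ∀ v u → lookup (N H v) u ≡ adj H v u
  lookup-N v = lookup∘tabulate (adj H v)

  v∉N[v] : ∀ v → v ∉ N H v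
  v∉N[v] v = lookup≡false⇒∉ (trans (lookup-N v v) (irrefl H v))

  minDegree⇒¬adjToLeaf : MinDegreeAtLeast H 2 → ∀ v → ¬ AdjToLeaf H v
  minDegree⇒¬adjToLeaf δ≥2 v (u , _ , leaf) with subst (2 ≤_) leaf (δ≥2 u)
  ... | s≤s ()

module _ {k : ℕ} (H : Graph (suc k)) (w : Fin (suc k)) where

  neighbour-outside : ∀ {T b u} → ¬ Dominated H T w → Outside H w b → u ∈ T → Adj H b u → Outside H w u
  neighbour-outside ¬dw b-out u∈T bu (inj₁ refl) = b-out (inj₂ (trans (adj-sym H w _) bu))
  neighbour-outside ¬dw b-out u∈T bu (inj₂ wu)   = ¬dw (_ , u∈T , wu)

  outside⊆ : ComponentsP2 H w → ∀ {T} → DominatesAllBut H w T → ¬ Dominated H T w →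
             ∀ y → Outside H w y → y ∈ T
  outside⊆ P₂ dom ¬dw y y-out with P₂ y y-out
  ... | b , b-out , yb , component with dom b (λ b≡w → b-out (inj₁ b≡w))
  ...   | u , u∈T , bu with component u (step (step here yb b-out) bu (neighbour-outside ¬dw b-out u∈T bu))
  ...     | inj₁ refl = u∈T
  ...     | inj₂ refl = ⊥-elim (adj⇒≢ H bu refl)

  k≤∣removeAt∣+deg : ∀ {T} → (∀ y → Outside H w y → y ∈ T) → k ≤ ∣ removeAt T w ∣ + deg H w
  k≤∣removeAt∣+deg {T} outside⊆T = begin
    k                                          ≡⟨ ∣⊤∣≡n k ⟨
    ∣ ⊤ {k} ∣                                  ≤⟨ p⊆q⇒∣p∣≤∣q∣ {p = ⊤} (λ {j} _ → x∈p∪q⁺ (covered j)) ⟩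
    ∣ removeAt T w ∪ removeAt (N H w) w ∣      ≤⟨ ∣p∪q∣≤∣p∣+∣q∣ (removeAt T w) (removeAt (N H w) w) ⟩
    ∣ removeAt T w ∣ + ∣ removeAt (N H w) w ∣  ≡⟨ cong (∣ removeAt T w ∣ +_) (∣removeAt∣ (v∉N[v] H w)) ⟩
    ∣ removeAt T w ∣ + deg H w                 ∎
    where
    open ≤-Reasoning
    covered : ∀ j → j ∈ removeAt T w ⊎ j ∈ removeAt (N H w) w
    covered j with adj H w (punchIn w j) in wj
    ... | true  = inj₂ (lookup⇒[]= j _ (trans (lookup-removeAt (N H w) w j) (trans (lookup-N H w _) wj)))
    ... | false = inj₁ (lookup⇒[]= j _ (trans (lookup-removeAt T w j) ([]=⇒lookup (outside⊆T _ j-out))))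
      where
      j-out : Outside H w (punchIn w j)
      j-out (inj₁ j≡w) = punchInᵢ≢i w j j≡w
      j-out (inj₂ wj′) with trans (sym wj′) wj
      ... | ()

  γₜ≤suc∣removeAt∣ : ∀ {m Δ} → GammaT H m → suc k ≡ Δ + m → deg H w ≡ Δ → ComponentsP2 H w →
                     ∀ T → DominatesAllBut H w T → m ≤ suc ∣ removeAt T w ∣
  γₜ≤suc∣removeAt∣ {m} {Δ} (_ , minimal) order deg-w P₂ T dom with dominated? H T w
  ... | yes dw = subst (m ≤_) (∣insertAt∣ (removeAt T w) w true) (minimal _ T+w-isTDS)
    where
    T+w-isTDS : IsTDS H (insertAt (removeAt T w) w true)
    T+w-isTDS v = Dominated-mono H (⊆-insertAt-removeAt T w (λ _ → refl)) (allBut⇒isTDS H dom dw v)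
  ... | no ¬dw = +-cancelˡ-≤ Δ m (suc ∣ removeAt T w ∣) (begin
    Δ + m                            ≡⟨ order ⟨
    suc k                            ≤⟨ s≤s (k≤∣removeAt∣+deg (outside⊆ P₂ dom ¬dw)) ⟩
    suc (∣ removeAt T w ∣ + deg H w) ≡⟨ cong (λ d → suc (∣ removeAt T w ∣ + d)) deg-w ⟩
    suc (∣ removeAt T w ∣ + Δ)       ≡⟨ cong suc (+-comm _ Δ) ⟩
    suc (Δ + ∣ removeAt T w ∣)       ≡⟨ +-suc Δ _ ⟨
    Δ + suc ∣ removeAt T w ∣         ∎)
    where open ≤-Reasoning

module Amalgamation {k₁ k₂ : ℕ} (G₁ : Graph (suc k₁)) (v₁ : Fin (suc k₁))
                                (G₂ : Graph (suc k₂)) (v₂ : Fin (suc k₂)) where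

  G : Graph (suc (k₁ + k₂))
  G = amalgamation G₁ v₁ G₂ v₂

  L : Fin k₁ → Fin (suc (k₁ + k₂))
  L j = suc (j ↑ˡ k₂)

  R : Fin k₂ → Fin (suc (k₁ + k₂))
  R j = suc (k₁ ↑ʳ j)

  data Vertex : Fin (suc (k₁ + k₂)) → Set where
    centre : Vertex zero
    left   : ∀ j → Vertex (L j)
    right  : ∀ j → Vertex (R j)

  vertex : ∀ x → Vertex x
  vertex zero = centre
  vertex (suc i) with splitAt k₁ i | join-splitAt k₁ k₂ i
  ... | inj₁ j | refl = left j
  ... | inj₂ j | refl = right j

  -- The embeddings of G₁ and G₂ into G, defined on views so that they compute.
  ι₁ : ∀ {y} → PunchView v₁ y → Fin (suc (k₁ + k₂))
  ι₁ pivot       = zero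
  ι₁ (punched j) = L j

  ι₂ : ∀ {y} → PunchView v₂ y → Fin (suc (k₁ + k₂))
  ι₂ pivot       = zero
  ι₂ (punched j) = R j

  ι₁-cong : ∀ {x y} (p : PunchView v₁ x) (q : PunchView v₁ y) → x ≡ y → ι₁ p ≡ ι₁ q
  ι₁-cong pivot       pivot       _   = refl
  ι₁-cong pivot       (punched j) v≡j = ⊥-elim (punchInᵢ≢i v₁ j (sym v≡j))
  ι₁-cong (punched i) pivot       i≡v = ⊥-elim (punchInᵢ≢i v₁ i i≡v)
  ι₁-cong (punched i) (punched j) i≡j = cong L (punchIn-injective v₁ i j i≡j)

  ι₂-cong : ∀ {x y} (p : PunchView v₂ x) (q : PunchView v₂ y) → x ≡ y → ι₂ p ≡ ι₂ q
  ι₂-cong pivot       pivot       _   = refl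
  ι₂-cong pivot       (punched j) v≡j = ⊥-elim (punchInᵢ≢i v₂ j (sym v≡j))
  ι₂-cong (punched i) pivot       i≡v = ⊥-elim (punchInᵢ≢i v₂ i i≡v)
  ι₂-cong (punched i) (punched j) i≡j = cong R (punchIn-injective v₂ i j i≡j)

  adj-ι₁ : ∀ {x y} (p : PunchView v₁ x) (q : PunchView v₁ y) → adj G (ι₁ p) (ι₁ q) ≡ adj G₁ x y
  adj-ι₁ pivot       pivot       = sym (irrefl G₁ v₁)
  adj-ι₁ pivot       (punched j) rewrite splitAt-↑ˡ k₁ j k₂ = refl
  adj-ι₁ (punched i) pivot       rewrite splitAt-↑ˡ k₁ i k₂ = refl
  adj-ι₁ (punched i) (punched j) rewrite splitAt-↑ˡ k₁ i k₂ | splitAt-↑ˡ k₁ j k₂ = refl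

  adj-ι₂ : ∀ {x y} (p : PunchView v₂ x) (q : PunchView v₂ y) → adj G (ι₂ p) (ι₂ q) ≡ adj G₂ x y
  adj-ι₂ pivot       pivot       = sym (irrefl G₂ v₂)
  adj-ι₂ pivot       (punched j) rewrite splitAt-↑ʳ k₁ k₂ j = refl
  adj-ι₂ (punched i) pivot       rewrite splitAt-↑ʳ k₁ k₂ i = refl
  adj-ι₂ (punched i) (punched j) rewrite splitAt-↑ʳ k₁ k₂ i | splitAt-↑ʳ k₁ k₂ j = refl

  adj-L-R : ∀ i j → adj G (L i) (R j) ≡ false
  adj-L-R i j rewrite splitAt-↑ˡ k₁ i k₂ | splitAt-↑ʳ k₁ k₂ j = refl

  adj-R-L : ∀ i j → adj G (R i) (L j) ≡ false
  adj-R-L i j rewrite splitAt-↑ʳ k₁ k₂ i | splitAt-↑ˡ k₁ j k₂ = refl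

  glue : Bool → Subset k₁ → Subset k₂ → Subset (suc (k₁ + k₂))
  glue b xs ys = b ∷ xs ++ ys

  ∣glue∣≡∣insertAt∣+∣ys∣ : ∀ b xs ys → ∣ glue b xs ys ∣ ≡ ∣ insertAt xs v₁ b ∣ + ∣ ys ∣
  ∣glue∣≡∣insertAt∣+∣ys∣ b xs ys = begin
    ∣ b ∷ xs ++ ys ∣              ≡⟨ trans (∣b∷p∣ b (xs ++ ys)) (cong (bit b +_) (∣p++q∣ xs ys)) ⟩
    bit b + (∣ xs ∣ + ∣ ys ∣)     ≡⟨ +-assoc (bit b) ∣ xs ∣ ∣ ys ∣ ⟨
    bit b + ∣ xs ∣ + ∣ ys ∣       ≡⟨ cong (_+ ∣ ys ∣) (∣insertAt∣ xs v₁ b) ⟨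
    ∣ insertAt xs v₁ b ∣ + ∣ ys ∣ ∎
    where open ≡-Reasoning

  ∣glue∣≡∣xs∣+∣insertAt∣ : ∀ b xs ys → ∣ glue b xs ys ∣ ≡ ∣ xs ∣ + ∣ insertAt ys v₂ b ∣
  ∣glue∣≡∣xs∣+∣insertAt∣ b xs ys = begin
    ∣ b ∷ xs ++ ys ∣              ≡⟨ trans (∣b∷p∣ b (xs ++ ys)) (cong (bit b +_) (∣p++q∣ xs ys)) ⟩
    bit b + (∣ xs ∣ + ∣ ys ∣)     ≡⟨ x∙yz≈y∙xz (bit b) ∣ xs ∣ ∣ ys ∣ ⟩
    ∣ xs ∣ + (bit b + ∣ ys ∣)     ≡⟨ cong (∣ xs ∣ +_) (∣insertAt∣ ys v₂ b) ⟨
    ∣ xs ∣ + ∣ insertAt ys v₂ b ∣ ∎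
    where open ≡-Reasoning

  lookup-glue-ι₁ : ∀ b xs ys {u} (p : PunchView v₁ u) →
                   lookup (glue b xs ys) (ι₁ p) ≡ lookup (insertAt xs v₁ b) u
  lookup-glue-ι₁ b xs ys pivot       = sym (insertAt-lookup xs v₁ b)
  lookup-glue-ι₁ b xs ys (punched j) = trans (lookup-++ˡ xs ys j) (sym (insertAt-punchIn xs v₁ b j))

  lookup-glue-ι₂ : ∀ b xs ys {u} (p : PunchView v₂ u) →
                   lookup (glue b xs ys) (ι₂ p) ≡ lookup (insertAt ys v₂ b) u
  lookup-glue-ι₂ b xs ys pivot       = sym (insertAt-lookup ys v₂ b)
  lookup-glue-ι₂ b xs ys (punched j) = trans (lookup-++ʳ xs ys j) (sym (insertAt-punchIn ys v₂ b j))

  module _ {b : Bool} {xs : Subset k₁} {ys : Subset k₂} where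

    dominated-ι₁ : ∀ {y} (q : PunchView v₁ y) → Dominated G₁ (insertAt xs v₁ b) y →
                   Dominated G (glue b xs ys) (ι₁ q)
    dominated-ι₁ q (u , u∈ , yu) =
      ι₁ p , lookup⇒[]= (ι₁ p) _ (trans (lookup-glue-ι₁ b xs ys p) ([]=⇒lookup u∈)) ,
      trans (adj-ι₁ q p) yu
      where p = punchView v₁ u

    dominated-ι₂ : ∀ {y} (q : PunchView v₂ y) → Dominated G₂ (insertAt ys v₂ b) y →
                   Dominated G (glue b xs ys) (ι₂ q)
    dominated-ι₂ q (u , u∈ , yu) =
      ι₂ p , lookup⇒[]= (ι₂ p) _ (trans (lookup-glue-ι₂ b xs ys p) ([]=⇒lookup u∈)) ,
      trans (adj-ι₂ q p) yu
      where p = punchView v₂ u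

    dominated-ι₁⁻ : ∀ {y u} (q : PunchView v₁ y) (p : PunchView v₁ u) →
                    ι₁ p ∈ glue b xs ys → Adj G (ι₁ q) (ι₁ p) → Dominated G₁ (insertAt xs v₁ b) y
    dominated-ι₁⁻ {u = u} q p u∈ yu =
      u , lookup⇒[]= u _ (trans (sym (lookup-glue-ι₁ b xs ys p)) ([]=⇒lookup u∈)) ,
      trans (sym (adj-ι₁ q p)) yu

    dominated-ι₂⁻ : ∀ {y u} (q : PunchView v₂ y) (p : PunchView v₂ u) →
                    ι₂ p ∈ glue b xs ys → Adj G (ι₂ q) (ι₂ p) → Dominated G₂ (insertAt ys v₂ b) y
    dominated-ι₂⁻ {u = u} q p u∈ yu =
      u , lookup⇒[]= u _ (trans (sym (lookup-glue-ι₂ b xs ys p)) ([]=⇒lookup u∈)) ,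
      trans (sym (adj-ι₂ q p)) yu

    dominated-L⁻ : ∀ j → Dominated G (glue b xs ys) (L j) → Dominated G₁ (insertAt xs v₁ b) (punchIn v₁ j)
    dominated-L⁻ j (u , u∈ , ju) with vertex u
    ... | centre   = dominated-ι₁⁻ (punched j) pivot u∈ ju
    ... | left j′  = dominated-ι₁⁻ (punched j) (punched j′) u∈ ju
    ... | right j′ with trans (sym ju) (adj-L-R j j′)
    ...   | ()

    dominated-R⁻ : ∀ j → Dominated G (glue b xs ys) (R j) → Dominated G₂ (insertAt ys v₂ b) (punchIn v₂ j)
    dominated-R⁻ j (u , u∈ , ju) with vertex u
    ... | centre   = dominated-ι₂⁻ (punched j) pivot u∈ ju
    ... | right j′ = dominated-ι₂⁻ (punched j) (punched j′) u∈ ju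
    ... | left j′ with trans (sym ju) (adj-R-L j j′)
    ...   | ()

    dominated-centre⁻ : Dominated G (glue b xs ys) zero →
                        Dominated G₁ (insertAt xs v₁ b) v₁ ⊎ Dominated G₂ (insertAt ys v₂ b) v₂
    dominated-centre⁻ (u , u∈ , zu) with vertex u
    ... | centre  = ⊥-elim (adj⇒≢ G {zero} zu refl)
    ... | left j  = inj₁ (dominated-ι₁⁻ pivot (punched j) u∈ zu)
    ... | right j = inj₂ (dominated-ι₂⁻ pivot (punched j) u∈ zu)

    restrict₁-dominatesAllBut : IsTDS G (glue b xs ys) → DominatesAllBut G₁ v₁ (insertAt xs v₁ b)
    restrict₁-dominatesAllBut tds y y≢v with punchView v₁ y
    ... | pivot     = ⊥-elim (y≢v refl)
    ... | punched j = dominated-L⁻ j (tds (L j))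

    restrict₂-dominatesAllBut : IsTDS G (glue b xs ys) → DominatesAllBut G₂ v₂ (insertAt ys v₂ b)
    restrict₂-dominatesAllBut tds y y≢v with punchView v₂ y
    ... | pivot     = ⊥-elim (y≢v refl)
    ... | punched j = dominated-R⁻ j (tds (R j))

  merge : Subset (suc k₁) → Subset (suc k₂) → Subset (suc (k₁ + k₂))
  merge T₁ T₂ = glue (lookup T₁ v₁ ∨ lookup T₂ v₂) (removeAt T₁ v₁) (removeAt T₂ v₂)

  module _ {T₁ : Subset (suc k₁)} {T₂ : Subset (suc k₂)} where

    ∣merge∣ : v₁ ∉ T₁ ⊎ v₂ ∉ T₂ → ∣ merge T₁ T₂ ∣ ≡ ∣ T₁ ∣ + ∣ T₂ ∣
    ∣merge∣ (inj₁ v₁∉T₁) rewrite ∉⇒lookup≡false v₁∉T₁ =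
      trans (∣glue∣≡∣xs∣+∣insertAt∣ (lookup T₂ v₂) (removeAt T₁ v₁) (removeAt T₂ v₂))
            (cong₂ _+_ (∣removeAt∣ v₁∉T₁) (cong ∣_∣ (insertAt-removeAt T₂ v₂)))
    ∣merge∣ (inj₂ v₂∉T₂) rewrite ∉⇒lookup≡false v₂∉T₂ | ∨-identityʳ (lookup T₁ v₁) =
      trans (∣glue∣≡∣insertAt∣+∣ys∣ (lookup T₁ v₁) (removeAt T₁ v₁) (removeAt T₂ v₂))
            (cong₂ _+_ (cong ∣_∣ (insertAt-removeAt T₁ v₁)) (∣removeAt∣ v₂∉T₂))

    lookup-merge-L : ∀ j → lookup (merge T₁ T₂) (L j) ≡ lookup T₁ (punchIn v₁ j)
    lookup-merge-L j = trans (lookup-++ˡ (removeAt T₁ v₁) (removeAt T₂ v₂) j) (lookup-removeAt T₁ v₁ j)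

    lookup-merge-R : ∀ j → lookup (merge T₁ T₂) (R j) ≡ lookup T₂ (punchIn v₂ j)
    lookup-merge-R j = trans (lookup-++ʳ (removeAt T₁ v₁) (removeAt T₂ v₂) j) (lookup-removeAt T₂ v₂ j)

    tabulate≡merge : ∀ {f : Fin (suc (k₁ + k₂)) → Bool} → f zero ≡ lookup T₁ v₁ ∨ lookup T₂ v₂ →
                     (∀ j → f (L j) ≡ lookup T₁ (punchIn v₁ j)) →
                     (∀ j → f (R j) ≡ lookup T₂ (punchIn v₂ j)) →
                     tabulate f ≡ merge T₁ T₂
    tabulate≡merge {f} f-centre f-L f-R = trans (tabulate-cong pointwise) (tabulate∘lookup (merge T₁ T₂))
      where
      pointwise : ∀ x → f x ≡ lookup (merge T₁ T₂) x
      pointwise x with vertex x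
      ... | centre  = f-centre
      ... | left j  = trans (f-L j) (sym (lookup-merge-L j))
      ... | right j = trans (f-R j) (sym (lookup-merge-R j))

    ι₁∉merge : ∀ {x} (q : PunchView v₁ x) → x ∉ T₁ → v₂ ∉ T₂ → ι₁ q ∉ merge T₁ T₂
    ι₁∉merge pivot       v₁∉T₁ v₂∉T₂ =
      lookup≡false⇒∉ (cong₂ _∨_ (∉⇒lookup≡false v₁∉T₁) (∉⇒lookup≡false v₂∉T₂))
    ι₁∉merge (punched j) x∉T₁  _     = lookup≡false⇒∉ (trans (lookup-merge-L j) (∉⇒lookup≡false x∉T₁))

    ι₂∉merge : ∀ {x} (q : PunchView v₂ x) → v₁ ∉ T₁ → x ∉ T₂ → ι₂ q ∉ merge T₁ T₂
    ι₂∉merge pivot       v₁∉T₁ v₂∉T₂ =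
      lookup≡false⇒∉ (cong₂ _∨_ (∉⇒lookup≡false v₁∉T₁) (∉⇒lookup≡false v₂∉T₂))
    ι₂∉merge (punched j) _     x∉T₂  = lookup≡false⇒∉ (trans (lookup-merge-R j) (∉⇒lookup≡false x∉T₂))

    dominated-merge₁ : ∀ {y} (q : PunchView v₁ y) → Dominated G₁ T₁ y → Dominated G (merge T₁ T₂) (ι₁ q)
    dominated-merge₁ q d = dominated-ι₁ q (Dominated-mono G₁ (⊆-insertAt-removeAt T₁ v₁ v₁∈T₁⇒) d)
      where
      v₁∈T₁⇒ : v₁ ∈ T₁ → lookup T₁ v₁ ∨ lookup T₂ v₂ ≡ true
      v₁∈T₁⇒ v₁∈T₁ = cong (_∨ lookup T₂ v₂) ([]=⇒lookup v₁∈T₁)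

    dominated-merge₂ : ∀ {y} (q : PunchView v₂ y) → Dominated G₂ T₂ y → Dominated G (merge T₁ T₂) (ι₂ q)
    dominated-merge₂ q d = dominated-ι₂ q (Dominated-mono G₂ (⊆-insertAt-removeAt T₂ v₂ v₂∈T₂⇒) d)
      where
      v₂∈T₂⇒ : v₂ ∈ T₂ → lookup T₁ v₁ ∨ lookup T₂ v₂ ≡ true
      v₂∈T₂⇒ v₂∈T₂ = trans (cong (lookup T₁ v₁ ∨_) ([]=⇒lookup v₂∈T₂)) (∨-zeroʳ (lookup T₁ v₁))

  N-centre : N G zero ≡ merge (N G₁ v₁) (N G₂ v₂)
  N-centre = tabulate≡merge {N G₁ v₁} {N G₂ v₂} {adj G zero}
    (sym (cong₂ _∨_ (∉⇒lookup≡false (v∉N[v] G₁ v₁)) (∉⇒lookup≡false (v∉N[v] G₂ v₂))))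
    (λ j → trans (adj-ι₁ pivot (punched j)) (sym (lookup-N G₁ v₁ _)))
    (λ j → trans (adj-ι₂ pivot (punched j)) (sym (lookup-N G₂ v₂ _)))

  N-L : ∀ i → N G (L i) ≡ merge (N G₁ (punchIn v₁ i)) ∅
  N-L i = tabulate≡merge {N G₁ (punchIn v₁ i)} {∅} {adj G (L i)}
    (trans (adj-ι₁ (punched i) pivot)
      (sym (trans (cong (_ ∨_) (lookup-replicate v₂ false)) (trans (∨-identityʳ _) (lookup-N G₁ _ v₁)))))
    (λ j → trans (adj-ι₁ (punched i) (punched j)) (sym (lookup-N G₁ _ _)))
    (λ j → trans (adj-L-R i j) (sym (lookup-replicate (punchIn v₂ j) false)))

  N-R : ∀ i → N G (R i) ≡ merge ∅ (N G₂ (punchIn v₂ i))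
  N-R i = tabulate≡merge {∅} {N G₂ (punchIn v₂ i)} {adj G (R i)}
    (trans (adj-ι₂ (punched i) pivot)
      (sym (trans (cong (_∨ _) (lookup-replicate v₁ false)) (lookup-N G₂ _ v₂))))
    (λ j → trans (adj-R-L i j) (sym (lookup-replicate (punchIn v₁ j) false)))
    (λ j → trans (adj-ι₂ (punched i) (punched j)) (sym (lookup-N G₂ _ _)))

  deg-centre : deg G zero ≡ deg G₁ v₁ + deg G₂ v₂
  deg-centre = trans (cong ∣_∣ N-centre) (∣merge∣ {N G₁ v₁} {N G₂ v₂} (inj₂ (v∉N[v] G₂ v₂)))

  deg-L : ∀ i → deg G (L i) ≡ deg G₁ (punchIn v₁ i)
  deg-L i = begin
    deg G (L i)                             ≡⟨ cong ∣_∣ (N-L i) ⟩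
    ∣ merge (N G₁ (punchIn v₁ i)) ∅ ∣       ≡⟨ ∣merge∣ {N G₁ (punchIn v₁ i)} {∅} (inj₂ (∉⊥ {x = v₂})) ⟩
    deg G₁ (punchIn v₁ i) + ∣ ∅ {suc k₂} ∣  ≡⟨ cong (deg G₁ (punchIn v₁ i) +_) (∣⊥∣≡0 (suc k₂)) ⟩
    deg G₁ (punchIn v₁ i) + 0               ≡⟨ +-identityʳ _ ⟩
    deg G₁ (punchIn v₁ i)                   ∎
    where open ≡-Reasoning

  deg-R : ∀ i → deg G (R i) ≡ deg G₂ (punchIn v₂ i)
  deg-R i = begin
    deg G (R i)                             ≡⟨ cong ∣_∣ (N-R i) ⟩
    ∣ merge ∅ (N G₂ (punchIn v₂ i)) ∣       ≡⟨ ∣merge∣ {∅} {N G₂ (punchIn v₂ i)} (inj₁ (∉⊥ {x = v₁})) ⟩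
    ∣ ∅ {suc k₁} ∣ + deg G₂ (punchIn v₂ i)  ≡⟨ cong (_+ deg G₂ (punchIn v₂ i)) (∣⊥∣≡0 (suc k₁)) ⟩
    deg G₂ (punchIn v₂ i)                   ∎
    where open ≡-Reasoning

  maxDegree : ∀ {Δ₁ Δ₂} → (∀ v → deg G₁ v ≤ Δ₁) → (∀ v → deg G₂ v ≤ Δ₂) →
              deg G₁ v₁ ≡ Δ₁ → deg G₂ v₂ ≡ Δ₂ → MaxDegreeIs G (Δ₁ + Δ₂)
  maxDegree {Δ₁} {Δ₂} ≤Δ₁ ≤Δ₂ deg-v₁ deg-v₂ = (zero , deg-zero) , ≤Δ₁+Δ₂
    where
    deg-zero : deg G zero ≡ Δ₁ + Δ₂
    deg-zero = trans deg-centre (cong₂ _+_ deg-v₁ deg-v₂)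

    ≤Δ₁+Δ₂ : ∀ x → deg G x ≤ Δ₁ + Δ₂
    ≤Δ₁+Δ₂ x with vertex x
    ... | centre  = ≤-reflexive deg-zero
    ... | left j  = subst (_≤ Δ₁ + Δ₂) (sym (deg-L j)) (≤-trans (≤Δ₁ _) (m≤m+n Δ₁ Δ₂))
    ... | right j = subst (_≤ Δ₁ + Δ₂) (sym (deg-R j)) (≤-trans (≤Δ₂ _) (m≤n+m Δ₂ Δ₁))

  merge-isTDS : ∀ {T₁ T₂} → IsTDS G₁ T₁ → DominatesAllBut G₂ v₂ T₂ → IsTDS G (merge T₁ T₂)
  merge-isTDS {T₁} {T₂} dom₁ dom₂ x with vertex x
  ... | centre  = dominated-merge₁ {T₂ = T₂} pivot (dom₁ v₁)
  ... | left j  = dominated-merge₁ {T₂ = T₂} (punched j) (dom₁ _)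
  ... | right j = dominated-merge₂ {T₁ = T₁} (punched j) (dom₂ _ (punchInᵢ≢i v₂ j))

  merge-isTDSMinus₁ : ∀ {x T₁ T₂} (q : PunchView v₁ x) →
                      IsTDSMinus G₁ x T₁ → IsTDSMinus G₂ v₂ T₂ → IsTDSMinus G (ι₁ q) (merge T₁ T₂)
  merge-isTDSMinus₁ {T₁ = T₁} {T₂} q (x∉T₁ , dom₁) (v₂∉T₂ , dom₂) = ι₁∉merge q x∉T₁ v₂∉T₂ , dom
    where
    dom : ∀ y → y ≢ ι₁ q → Dominated G (merge T₁ T₂) y
    dom y y≢ with vertex y
    ... | centre  = dominated-merge₁ {T₂ = T₂} pivot (dom₁ v₁ (λ v₁≡x → y≢ (ι₁-cong pivot q v₁≡x)))
    ... | left j  = dominated-merge₁ {T₂ = T₂} (punched j) (dom₁ _ (λ j≡x → y≢ (ι₁-cong (punched j) q j≡x)))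
    ... | right j = dominated-merge₂ {T₁ = T₁} (punched j) (dom₂ _ (punchInᵢ≢i v₂ j))

  merge-isTDSMinus₂ : ∀ {x T₁ T₂} (q : PunchView v₂ x) →
                      IsTDSMinus G₁ v₁ T₁ → IsTDSMinus G₂ x T₂ → IsTDSMinus G (ι₂ q) (merge T₁ T₂)
  merge-isTDSMinus₂ {T₁ = T₁} {T₂} q (v₁∉T₁ , dom₁) (x∉T₂ , dom₂) = ι₂∉merge q v₁∉T₁ x∉T₂ , dom
    where
    dom : ∀ y → y ≢ ι₂ q → Dominated G (merge T₁ T₂) y
    dom y y≢ with vertex y
    ... | centre  = dominated-merge₂ {T₁ = T₁} pivot (dom₂ v₂ (λ v₂≡x → y≢ (ι₂-cong pivot q v₂≡x)))
    ... | right j = dominated-merge₂ {T₁ = T₁} (punched j) (dom₂ _ (λ j≡x → y≢ (ι₂-cong (punched j) q j≡x)))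
    ... | left j  = dominated-merge₁ {T₂ = T₂} (punched j) (dom₁ _ (punchInᵢ≢i v₁ j))

  γₜ-lower : ∀ {m₁ m₂} → GammaT G₁ m₁ → GammaT G₂ m₂ →
             (∀ T → DominatesAllBut G₁ v₁ T → m₁ ≤ suc ∣ removeAt T v₁ ∣) →
             (∀ T → DominatesAllBut G₂ v₂ T → m₂ ≤ suc ∣ removeAt T v₂ ∣) →
             ∀ S → IsTDS G S → m₁ + m₂ ∸ 1 ≤ ∣ S ∣
  γₜ-lower {m₁} {m₂} (_ , minimal₁) (_ , minimal₂) bound₁ bound₂ (b ∷ zs) tds with Vec.splitAt k₁ zs
  ... | xs , ys , refl with dominated-centre⁻ (tds zero)
  ...   | inj₁ d₁ =
    subst (m₁ + m₂ ∸ 1 ≤_) (sym (∣glue∣≡∣insertAt∣+∣ys∣ b xs ys)) (+∸1-mono-≤ʳ m₁≤∣T₁∣ m₂≤1+∣ys∣)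
    where
    m₁≤∣T₁∣ : m₁ ≤ ∣ insertAt xs v₁ b ∣
    m₁≤∣T₁∣ = minimal₁ _ (allBut⇒isTDS G₁ (restrict₁-dominatesAllBut tds) d₁)
    m₂≤1+∣ys∣ : m₂ ≤ suc ∣ ys ∣
    m₂≤1+∣ys∣ = subst (λ zs → m₂ ≤ suc ∣ zs ∣) (removeAt-insertAt ys v₂ b)
                      (bound₂ _ (restrict₂-dominatesAllBut tds))
  ...   | inj₂ d₂ =
    subst (m₁ + m₂ ∸ 1 ≤_) (sym (∣glue∣≡∣xs∣+∣insertAt∣ b xs ys)) (+∸1-mono-≤ˡ m₁≤1+∣xs∣ m₂≤∣T₂∣)
    where
    m₁≤1+∣xs∣ : m₁ ≤ suc ∣ xs ∣
    m₁≤1+∣xs∣ = subst (λ zs → m₁ ≤ suc ∣ zs ∣) (removeAt-insertAt xs v₁ b)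
                      (bound₁ _ (restrict₁-dominatesAllBut tds))
    m₂≤∣T₂∣ : m₂ ≤ ∣ insertAt ys v₂ b ∣
    m₂≤∣T₂∣ = minimal₂ _ (allBut⇒isTDS G₂ (restrict₂-dominatesAllBut tds) d₂)

  γₜ-amalgamation : ∀ {m₁ m₂} → GammaT G₁ m₁ → GammaTMinusLess G₂ v₂ m₂ →
                    (∀ S → IsTDS G S → m₁ + m₂ ∸ 1 ≤ ∣ S ∣) → GammaT G (m₁ + m₂ ∸ 1)
  γₜ-amalgamation {m₁} {m₂} ((T₁ , tds₁ , ∣T₁∣≡m₁) , _) (T₂ , (v₂∉T₂ , dom₂) , ∣T₂∣<m₂) lower =
    (merge T₁ T₂ , tds , ≤-antisym ∣merge∣≤ (lower _ tds)) , lower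
    where
    tds : IsTDS G (merge T₁ T₂)
    tds = merge-isTDS tds₁ dom₂
    ∣merge∣≤ : ∣ merge T₁ T₂ ∣ ≤ m₁ + m₂ ∸ 1
    ∣merge∣≤ = subst (_≤ m₁ + m₂ ∸ 1)
                     (sym (trans (∣merge∣ {T₁} {T₂} (inj₂ v₂∉T₂)) (cong (_+ ∣ T₂ ∣) ∣T₁∣≡m₁)))
                     (+-<ʳ⇒≤+∸1 ∣T₂∣<m₂)

  module _ {m₁ m₂} (crit₁ : ∀ x → GammaTMinusLess G₁ x m₁) (crit₂ : ∀ x → GammaTMinusLess G₂ x m₂) where

    critical-ι₁ : ∀ {y} (q : PunchView v₁ y) → GammaTMinusLess G (ι₁ q) (m₁ + m₂ ∸ 1)
    critical-ι₁ {y} q with crit₁ y | crit₂ v₂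
    ... | T₁ , minus₁ , ∣T₁∣<m₁ | T₂ , minus₂@(v₂∉T₂ , _) , ∣T₂∣<m₂ =
      merge T₁ T₂ , merge-isTDSMinus₁ q minus₁ minus₂ ,
      subst (_< m₁ + m₂ ∸ 1) (sym (∣merge∣ {T₁} {T₂} (inj₂ v₂∉T₂))) (+-<⇒<+∸1 ∣T₁∣<m₁ ∣T₂∣<m₂)

    critical-ι₂ : ∀ {y} (q : PunchView v₂ y) → GammaTMinusLess G (ι₂ q) (m₁ + m₂ ∸ 1)
    critical-ι₂ {y} q with crit₁ v₁ | crit₂ y
    ... | T₁ , minus₁@(v₁∉T₁ , _) , ∣T₁∣<m₁ | T₂ , minus₂ , ∣T₂∣<m₂ =
      merge T₁ T₂ , merge-isTDSMinus₂ q minus₁ minus₂ ,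
      subst (_< m₁ + m₂ ∸ 1) (sym (∣merge∣ {T₁} {T₂} (inj₁ v₁∉T₁))) (+-<⇒<+∸1 ∣T₁∣<m₁ ∣T₂∣<m₂)

    critical-amalgamation : ∀ x → GammaTMinusLess G x (m₁ + m₂ ∸ 1)
    critical-amalgamation x with vertex x
    ... | centre  = critical-ι₁ pivot
    ... | left j  = critical-ι₁ (punched j)
    ... | right j = critical-ι₂ (punched j)

lemma4 : (k₁ k₂ m₁ m₂ Δ₁ Δ₂ : ℕ)
    (G₁ : Graph (suc k₁)) (G₂ : Graph (suc k₂))
    (v₁ : Fin (suc k₁)) (v₂ : Fin (suc k₂)) →
    Critical G₁ m₁ → Critical G₂ m₂ →
    MaxDegreeIs G₁ Δ₁ → MaxDegreeIs G₂ Δ₂ →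
    suc k₁ ≡ Δ₁ + m₁ → suc k₂ ≡ Δ₂ + m₂ →
    MinDegreeAtLeast G₁ 2 → MinDegreeAtLeast G₂ 2 →
    deg G₁ v₁ ≡ Δ₁ → deg G₂ v₂ ≡ Δ₂ →
    ComponentsP2 G₁ v₁ → ComponentsP2 G₂ v₂ →
    MaxDegreeIs (amalgamation G₁ v₁ G₂ v₂) (Δ₁ + Δ₂)
    × Critical (amalgamation G₁ v₁ G₂ v₂) (m₁ + m₂ ∸ 1)
    × suc (k₁ + k₂) ≡ (Δ₁ + Δ₂) + (m₁ + m₂ ∸ 1)
lemma4 k₁ k₂ m₁ m₂ Δ₁ Δ₂ G₁ G₂ v₁ v₂ (_ , γ₁ , crit₁) (_ , γ₂ , crit₂) (_ , ≤Δ₁) (_ , ≤Δ₂)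
       n₁ n₂ δ₁ δ₂ deg-v₁ deg-v₂ P₁ P₂ =
  maxDegree ≤Δ₁ ≤Δ₂ deg-v₁ deg-v₂ ,
  (γₜ⇒noIsolated G γ , γ , λ x _ → critical-amalgamation crit₁′ crit₂′ x) ,
  +-interchange-∸1 {Δ₁ = Δ₁} {m₁ = m₁} n₁ n₂ (≤-trans (s≤s z≤n) (proj₂ (proj₂ (crit₂′ v₂))))
  where
  open Amalgamation G₁ v₁ G₂ v₂

  crit₁′ : ∀ x → GammaTMinusLess G₁ x m₁
  crit₁′ x = crit₁ x (minDegree⇒¬adjToLeaf G₁ δ₁ x)

  crit₂′ : ∀ x → GammaTMinusLess G₂ x m₂
  crit₂′ x = crit₂ x (minDegree⇒¬adjToLeaf G₂ δ₂ x)

  γ : GammaT G (m₁ + m₂ ∸ 1)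
  γ = γₜ-amalgamation γ₁ (crit₂′ v₂)
        (γₜ-lower γ₁ γ₂ (γₜ≤suc∣removeAt∣ G₁ v₁ γ₁ n₁ deg-v₁ P₁) (γₜ≤suc∣removeAt∣ G₂ v₂ γ₂ n₂ deg-v₂ P₂))
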